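{- For every finite multiset $\Gamma$ of formulas and every formula $C$: $\Gamma\Rightarrow C$ is derivable in $\mathsf{GWFCI}$ if and only if $\vdash_{\mathsf{WFCI}}\bigwedge\Gamma\rightarrow C$.
   Context: Formulas are built from a countable set of propositional atoms and $\bot$ using $\wedge,\vee,\rightarrow$; $A\leftrightarrow B$ abbreviates $(A\rightarrow B)\wedge(B\rightarrow A)$. $\bigwedge\Gamma$ is the conjunction of the formulas of $\Gamma$ (empty conjunction read as $\bot\rightarrow\bot$). Sequent calculus $\mathsf{GWFCI}$ (sequents $\Gamma\Rightarrow C$, $\Gamma$ finite multiset, $C$ a formula, $p$ atomic): (Ax) $p,\Gamma\Rightarrow p$; ($\bot_L$) $\bot,\Gamma\Rightarrow C$; ($\wedge_L$) from $A,B,\Gamma\Rightarrow C$ infer $A\wedge B,\Gamma\Rightarrow C$; ($\wedge_R$) from $\Gamma\Rightarrow A$ and $\Gamma\Rightarrow B$ infer $\Gamma\Rightarrow A\wedge B$; ($\vee_L$) from $A,\Gamma\Rightarrow C$ and $B,\Gamma\Rightarrow C$ infer $A\vee B,\Gamma\Rightarrow C$; ($\vee_R^1$) from $\Gamma\Rightarrow A$ infer $\Gamma\Rightarrow A\vee B$; ($\vee_R^2$) from $\Gamma\Rightarrow B$ infer $\Gamma\Rightarrow A\vee B$; ($\rightarrow_R$) from $A\Rightarrow B$ infer $\Gamma\Rightarrow A\rightarrow B$; ($\rightarrow_{LR}$) from $A\Rightarrow B$, $B\Rightarrow A$, $C\Rightarrow D$, $D\Rightarrow C$ infer $\Gamma,A\rightarrow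 C\Rightarrow B\rightarrow D$; ($\rightarrow_I$) from $\Gamma\Rightarrow B\rightarrow C$ and $\Gamma\Rightarrow C\rightarrow D$ infer $\Gamma\Rightarrow B\rightarrow D$; ($\rightarrow_C$) from $\Gamma\Rightarrow B\rightarrow C$ and $\Gamma\Rightarrow B\rightarrow D$ infer $\Gamma\Rightarrow B\rightarrow C\wedge D$. Hilbert system $\mathsf{WF}$: axioms all instances of $A\rightarrow(A\vee B)$; $B\rightarrow(A\vee B)$; $(A\wedge B)\rightarrow A$; $(A\wedge B)\rightarrow B$; $A\wedge(B\vee C)\rightarrow(A\wedge B)\vee(A\wedge C)$; $A\rightarrow A$; $\bot\rightarrow A$; rules: from $A$, $A\rightarrow B$ infer $B$; from $A$ infer $B\rightarrow A$; from $A\rightarrow B$, $B\rightarrow C$ infer $A\rightarrow C$; from $A\rightarrow B$, $A\rightarrow C$ infer $A\rightarrow(B\wedge C)$; from $A\rightarrow C$, $B\rightarrow C$ infer $(A\vee B)\rightarrow C$; from $A$, $B$ infer $A\wedge B$; from $A\leftrightarrow B$, $C\leftrightarrow D$ infer $(A\rightarrow C)\leftrightarrow(B\rightarrow D)$. $\mathsf{WFCI}$ is $\mathsf{WF}$ plus all instances of the axioms $(A\rightarrow B)\wedge(B\rightarrow C)\rightarrow(A\rightarrow C)$ and $(A\rightarrow B)\wedge(A\rightarrow C)\rightarrow(A\rightarrow B\wedge C)$. -}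

module Defs where

open import Data.Nat using (ℕ)
open import Data.List using (List; []; _∷_)
open import Data.List.Relation.Binary.Permutation.Propositional using (_↭_)

data Formula : Set where
  atom : ℕ → Formula
  ⊥′   : Formula
  _∧′_ : Formula → Formula → Formula
  _∨′_ : Formula → Formula → Formula
  _⇒′_ : Formula → Formula → Formula

infixr 6 _∧′_
infixr 5 _∨′_
infixr 4 _⇒′_

_⇔′_ : Formula → Formula → Formula
A ⇔′ B = (A ⇒′ B) ∧′ (B ⇒′ A)

-- Big conjunction; the empty conjunction is ⊥ → ⊥.
⋀ : List Formula → Formula
⋀ []           = ⊥′ ⇒′ ⊥′
⋀ (A ∷ [])     = A
⋀ (A ∷ B ∷ Γ)  = A ∧′ ⋀ (B ∷ Γ)

-- Sequent calculus GWFCI. Antecedents are multisets, represented as lists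
-- taken up to permutation (rule perm).
infix 3 _⊢G_
data _⊢G_ : List Formula → Formula → Set where
  perm  : ∀ {Γ Δ C} → Γ ↭ Δ → Γ ⊢G C → Δ ⊢G C
  ax    : ∀ {p Γ} → atom p ∷ Γ ⊢G atom p
  ⊥L    : ∀ {Γ C} → ⊥′ ∷ Γ ⊢G C
  ∧L    : ∀ {A B Γ C} → A ∷ B ∷ Γ ⊢G C → (A ∧′ B) ∷ Γ ⊢G C
  ∧R    : ∀ {Γ A B} → Γ ⊢G A → Γ ⊢G B → Γ ⊢G A ∧′ B
  ∨L    : ∀ {A B Γ C} → A ∷ Γ ⊢G C → B ∷ Γ ⊢G C → (A ∨′ B) ∷ Γ ⊢G C
  ∨R1   : ∀ {Γ A B} → Γ ⊢G A → Γ ⊢G A ∨′ B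
  ∨R2   : ∀ {Γ A B} → Γ ⊢G B → Γ ⊢G A ∨′ B
  ⇒R    : ∀ {Γ A B} → A ∷ [] ⊢G B → Γ ⊢G A ⇒′ B
  ⇒LR   : ∀ {Γ A B C D} → A ∷ [] ⊢G B → B ∷ [] ⊢G A → C ∷ [] ⊢G D → D ∷ [] ⊢G C
        → (A ⇒′ C) ∷ Γ ⊢G B ⇒′ D
  ⇒I    : ∀ {Γ B C D} → Γ ⊢G B ⇒′ C → Γ ⊢G C ⇒′ D → Γ ⊢G B ⇒′ D
  ⇒C    : ∀ {Γ B C D} → Γ ⊢G B ⇒′ C → Γ ⊢G B ⇒′ D → Γ ⊢G B ⇒′ (C ∧′ D)

data ⊢WFCI : Formula → Set where
  ax∨1    : ∀ {A B} → ⊢WFCI (A ⇒′ A ∨′ B)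
  ax∨2    : ∀ {A B} → ⊢WFCI (B ⇒′ A ∨′ B)
  ax∧1    : ∀ {A B} → ⊢WFCI (A ∧′ B ⇒′ A)
  ax∧2    : ∀ {A B} → ⊢WFCI (A ∧′ B ⇒′ B)
  axDist  : ∀ {A B C} → ⊢WFCI (A ∧′ (B ∨′ C) ⇒′ (A ∧′ B) ∨′ (A ∧′ C))
  axId    : ∀ {A} → ⊢WFCI (A ⇒′ A)
  ax⊥     : ∀ {A} → ⊢WFCI (⊥′ ⇒′ A)
  mp      : ∀ {A B} → ⊢WFCI A → ⊢WFCI (A ⇒′ B) → ⊢WFCI B
  weak    : ∀ {A B} → ⊢WFCI A → ⊢WFCI (B ⇒′ A)
  trans   : ∀ {A B C} → ⊢WFCI (A ⇒′ B) → ⊢WFCI (B ⇒′ C) → ⊢WFCI (A ⇒′ C)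
  conjI   : ∀ {A B C} → ⊢WFCI (A ⇒′ B) → ⊢WFCI (A ⇒′ C) → ⊢WFCI (A ⇒′ B ∧′ C)
  disjE   : ∀ {A B C} → ⊢WFCI (A ⇒′ C) → ⊢WFCI (B ⇒′ C) → ⊢WFCI (A ∨′ B ⇒′ C)
  adj     : ∀ {A B} → ⊢WFCI A → ⊢WFCI B → ⊢WFCI (A ∧′ B)
  cong⇒   : ∀ {A B C D} → ⊢WFCI (A ⇔′ B) → ⊢WFCI (C ⇔′ D)
          → ⊢WFCI ((A ⇒′ C) ⇔′ (B ⇒′ D))
  -- CI axioms
  axTr    : ∀ {A B C} → ⊢WFCI ((A ⇒′ B) ∧′ (B ⇒′ C) ⇒′ (A ⇒′ C))
  axCj    : ∀ {A B C} → ⊢WFCI ((A ⇒′ B) ∧′ (A ⇒′ C) ⇒′ (A ⇒′ B ∧′ C))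

-- GWFCI is first traded for a calculus whose left rules keep their principal
-- formula, located by membership, so that contraction and exchange are built
-- in. Weakening and cut are admissible there; cut only needs the rule ⇒I,
-- which composes B → A, the cut formula A → C and C → D when the cut formula
-- is principal in ⇒LR. Soundness for WFCI is then rule by rule, and each WFCI
-- axiom and rule is derivable with the help of cut. Back in GWFCI, a formula
-- kept by a left rule has already been decomposed, so the translation tracks
-- how each kept formula is rebuilt by ∧ and ∨ from the current antecedent.
module Submission where

open import Defs
open import Data.List using (List; []; _∷_)
open import Data.List.Membership.Propositional using (_∈_)
open import Data.List.Membership.Propositional.Properties using (∈-∃++)
open import Data.List.Relation.Unary.All as All using (All; _∷_; lookup; tabulate)
open import Data.List.Relation.Unary.Any using (here; there)
open import Data.List.Relation.Binary.Subset.Propositional using (_⊆_)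
open import Data.List.Relation.Binary.Subset.Propositional.Properties using (⊆-refl; ∷⁺ʳ)
open import Data.List.Relation.Binary.Permutation.Propositional using (_↭_; ↭-sym)
open import Data.List.Relation.Binary.Permutation.Propositional.Properties
  using (∈-resp-↭; All-resp-↭; shift)
open import Data.Product using (_×_; _,_)
open import Function using (_∘_)
open import Relation.Binary.PropositionalEquality using (refl)

infix 3 _⊢_

data _⊢_ : List Formula → Formula → Set where
  ax∈  : ∀ {p Γ} → atom p ∈ Γ → Γ ⊢ atom p
  ⊥L∈  : ∀ {Γ C} → ⊥′ ∈ Γ → Γ ⊢ C
  ∧L∈  : ∀ {A B Γ C} → A ∧′ B ∈ Γ → A ∷ B ∷ Γ ⊢ C → Γ ⊢ C
  ∨L∈  : ∀ {A B Γ C} → A ∨′ B ∈ Γ → A ∷ Γ ⊢ C → B ∷ Γ ⊢ C → Γ ⊢ C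
  ∧R   : ∀ {Γ A B} → Γ ⊢ A → Γ ⊢ B → Γ ⊢ A ∧′ B
  ∨R1  : ∀ {Γ A B} → Γ ⊢ A → Γ ⊢ A ∨′ B
  ∨R2  : ∀ {Γ A B} → Γ ⊢ B → Γ ⊢ A ∨′ B
  ⇒R   : ∀ {Γ A B} → A ∷ [] ⊢ B → Γ ⊢ A ⇒′ B
  ⇒LR∈ : ∀ {Γ A B C D} → (A ⇒′ C) ∈ Γ
       → A ∷ [] ⊢ B → B ∷ [] ⊢ A → C ∷ [] ⊢ D → D ∷ [] ⊢ C → Γ ⊢ B ⇒′ D
  ⇒I   : ∀ {Γ B C D} → Γ ⊢ B ⇒′ C → Γ ⊢ C ⇒′ D → Γ ⊢ B ⇒′ D
  ⇒C   : ∀ {Γ B C D} → Γ ⊢ B ⇒′ C → Γ ⊢ B ⇒′ D → Γ ⊢ B ⇒′ C ∧′ D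

weaken : ∀ {Γ Δ C} → Γ ⊆ Δ → Γ ⊢ C → Δ ⊢ C
weaken s (ax∈ m)          = ax∈ (s m)
weaken s (⊥L∈ m)          = ⊥L∈ (s m)
weaken s (∧L∈ m d)        = ∧L∈ (s m) (weaken (∷⁺ʳ _ (∷⁺ʳ _ s)) d)
weaken s (∨L∈ m d e)      = ∨L∈ (s m) (weaken (∷⁺ʳ _ s) d) (weaken (∷⁺ʳ _ s) e)
weaken s (∧R d e)         = ∧R (weaken s d) (weaken s e)
weaken s (∨R1 d)          = ∨R1 (weaken s d)
weaken s (∨R2 d)          = ∨R2 (weaken s d)
weaken s (⇒R d)           = ⇒R d
weaken s (⇒LR∈ m a b c d) = ⇒LR∈ (s m) a b c d
weaken s (⇒I d e)         = ⇒I (weaken s d) (weaken s e)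
weaken s (⇒C d e)         = ⇒C (weaken s d) (weaken s e)

assumption : ∀ A {Γ} → A ∈ Γ → Γ ⊢ A
assumption (atom p) m = ax∈ m
assumption ⊥′       m = ⊥L∈ m
assumption (A ∧′ B) m =
  ∧L∈ m (∧R (assumption A (here refl)) (assumption B (there (here refl))))
assumption (A ∨′ B) m =
  ∨L∈ m (∨R1 (assumption A (here refl))) (∨R2 (assumption B (here refl)))
assumption (A ⇒′ B) m = ⇒LR∈ m idA idA idB idB
  where
  idA = assumption A (here refl)
  idB = assumption B (here refl)

hyp₀ : ∀ {A Γ} → A ∷ Γ ⊢ A
hyp₀ = assumption _ (here refl)

hyp₁ : ∀ {A B Γ} → A ∷ B ∷ Γ ⊢ B
hyp₁ = assumption _ (there (here refl))

∧-inv₁ : ∀ {Γ A B} → Γ ⊢ A ∧′ B → Γ ⊢ A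
∧-inv₁ (⊥L∈ m)     = ⊥L∈ m
∧-inv₁ (∧L∈ m d)   = ∧L∈ m (∧-inv₁ d)
∧-inv₁ (∨L∈ m d e) = ∨L∈ m (∧-inv₁ d) (∧-inv₁ e)
∧-inv₁ (∧R d e)    = d

∧-inv₂ : ∀ {Γ A B} → Γ ⊢ A ∧′ B → Γ ⊢ B
∧-inv₂ (⊥L∈ m)     = ⊥L∈ m
∧-inv₂ (∧L∈ m d)   = ∧L∈ m (∧-inv₂ d)
∧-inv₂ (∨L∈ m d e) = ∨L∈ m (∧-inv₂ d) (∧-inv₂ e)
∧-inv₂ (∧R d e)    = e

⊥-inv : ∀ {Γ C} → Γ ⊢ ⊥′ → Γ ⊢ C
⊥-inv (⊥L∈ m)     = ⊥L∈ m
⊥-inv (∧L∈ m d)   = ∧L∈ m (⊥-inv d)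
⊥-inv (∨L∈ m d e) = ∨L∈ m (⊥-inv d) (⊥-inv e)

⊆-under : ∀ {A x : Formula} {Γ Δ} → Δ ⊆ A ∷ Γ → x ∷ Δ ⊆ A ∷ x ∷ Γ
⊆-under s (here refl) = there (here refl)
⊆-under s (there m) with s m
... | here refl = here refl
... | there m′  = there (there m′)

-- The side condition Δ ⊆ A ∷ Γ, rather than Δ ≡ A ∷ Γ, survives the left
-- rules, which push their components in front of the cut formula.
mutual
  cut : ∀ {A Γ Δ C} → Γ ⊢ A → Δ ⊢ C → Δ ⊆ A ∷ Γ → Γ ⊢ C
  cut a (ax∈ m) s with s m
  ... | here refl = a
  ... | there m′  = ax∈ m′
  cut a (⊥L∈ m) s with s m
  ... | here refl = ⊥-inv a
  ... | there m′  = ⊥L∈ m′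
  cut a (∧L∈ m d) s with s m
  ... | here refl =
    let d′ = cut (weaken (there ∘ there) a) d (⊆-under (⊆-under s))
    in cut (∧-inv₂ a) (cut (weaken there (∧-inv₁ a)) d′ ⊆-refl) ⊆-refl
  ... | there m′  = ∧L∈ m′ (cut (weaken (there ∘ there) a) d (⊆-under (⊆-under s)))
  cut a (∨L∈ m d e) s with s m
  ... | here refl = cut-∨ a (cut (weaken there a) d (⊆-under s)) (cut (weaken there a) e (⊆-under s))
  ... | there m′  = ∨L∈ m′ (cut (weaken there a) d (⊆-under s)) (cut (weaken there a) e (⊆-under s))
  cut a (∧R d e)   s = ∧R (cut a d s) (cut a e s)
  cut a (∨R1 d)    s = ∨R1 (cut a d s)
  cut a (∨R2 d)    s = ∨R2 (cut a d s)
  cut a (⇒R d)     s = ⇒R d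
  cut a (⇒LR∈ m ab ba cd dc) s with s m
  ... | here refl = ⇒I (⇒I (⇒R ba) a) (⇒R cd)
  ... | there m′  = ⇒LR∈ m′ ab ba cd dc
  cut a (⇒I d e)   s = ⇒I (cut a d s) (cut a e s)
  cut a (⇒C d e)   s = ⇒C (cut a d s) (cut a e s)

  cut-∨ : ∀ {A B Γ C} → Γ ⊢ A ∨′ B → A ∷ Γ ⊢ C → B ∷ Γ ⊢ C → Γ ⊢ C
  cut-∨ (⊥L∈ m)     d e = ⊥L∈ m
  cut-∨ (∧L∈ m a)   d e =
    ∧L∈ m (cut-∨ a (weaken (∷⁺ʳ _ (there ∘ there)) d) (weaken (∷⁺ʳ _ (there ∘ there)) e))
  cut-∨ (∨L∈ m a b) d e =
    ∨L∈ m (cut-∨ a (weaken (∷⁺ʳ _ there) d) (weaken (∷⁺ʳ _ there) e))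
          (cut-∨ b (weaken (∷⁺ʳ _ there) d) (weaken (∷⁺ʳ _ there) e))
  cut-∨ (∨R1 a)     d e = cut a d ⊆-refl
  cut-∨ (∨R2 b)     d e = cut b e ⊆-refl

⇒-inv : ∀ {A B} → [] ⊢ A ⇒′ B → A ∷ [] ⊢ B
⇒-inv (⊥L∈ ())
⇒-inv (∧L∈ () d)
⇒-inv (∨L∈ () d e)
⇒-inv (⇒R d)           = d
⇒-inv (⇒LR∈ () a b c d)
⇒-inv (⇒I d e)         = cut (⇒-inv d) (⇒-inv e) (∷⁺ʳ _ λ ())
⇒-inv (⇒C d e)         = ∧R (⇒-inv d) (⇒-inv e)

⇔-inv : ∀ {A B} → [] ⊢ A ⇔′ B → (A ∷ [] ⊢ B) × (B ∷ [] ⊢ A)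
⇔-inv d = ⇒-inv (∧-inv₁ d) , ⇒-inv (∧-inv₂ d)

⊢⋀ : ∀ Γ → Γ ⊢ ⋀ Γ
⊢⋀ []          = ⇒R hyp₀
⊢⋀ (A ∷ [])    = hyp₀
⊢⋀ (A ∷ B ∷ Γ) = ∧R hyp₀ (weaken there (⊢⋀ (B ∷ Γ)))

⊢G⇒⊢ : ∀ {Γ C} → Γ ⊢G C → Γ ⊢ C
⊢G⇒⊢ (perm p d)     = weaken (∈-resp-↭ p) (⊢G⇒⊢ d)
⊢G⇒⊢ ax             = ax∈ (here refl)
⊢G⇒⊢ ⊥L             = ⊥L∈ (here refl)
⊢G⇒⊢ (∧L d)         = ∧L∈ (here refl) (weaken (∷⁺ʳ _ (∷⁺ʳ _ there)) (⊢G⇒⊢ d))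
⊢G⇒⊢ (∨L d e)       =
  ∨L∈ (here refl) (weaken (∷⁺ʳ _ there) (⊢G⇒⊢ d)) (weaken (∷⁺ʳ _ there) (⊢G⇒⊢ e))
⊢G⇒⊢ (∧R d e)       = ∧R (⊢G⇒⊢ d) (⊢G⇒⊢ e)
⊢G⇒⊢ (∨R1 d)        = ∨R1 (⊢G⇒⊢ d)
⊢G⇒⊢ (∨R2 d)        = ∨R2 (⊢G⇒⊢ d)
⊢G⇒⊢ (⇒R d)         = ⇒R (⊢G⇒⊢ d)
⊢G⇒⊢ (⇒LR a b c d)  = ⇒LR∈ (here refl) (⊢G⇒⊢ a) (⊢G⇒⊢ b) (⊢G⇒⊢ c) (⊢G⇒⊢ d)
⊢G⇒⊢ (⇒I d e)       = ⇒I (⊢G⇒⊢ d) (⊢G⇒⊢ e)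
⊢G⇒⊢ (⇒C d e)       = ⇒C (⊢G⇒⊢ d) (⊢G⇒⊢ e)

data Covered (Δ : List Formula) : Formula → Set where
  member : ∀ {F} → F ∈ Δ → Covered Δ F
  both   : ∀ {A B} → Covered Δ A → Covered Δ B → Covered Δ (A ∧′ B)
  left   : ∀ {A B} → Covered Δ A → Covered Δ (A ∨′ B)
  right  : ∀ {A B} → Covered Δ B → Covered Δ (A ∨′ B)

member₀ : ∀ {A Δ} → Covered (A ∷ Δ) A
member₀ = member (here refl)

member₁ : ∀ {A B Δ} → Covered (A ∷ B ∷ Δ) B
member₁ = member (there (here refl))

infix 4 _⊑_

_⊑_ : List Formula → List Formula → Set
Γ ⊑ Δ = All (Covered Δ) Γ

⊑-refl : ∀ {Δ} → Δ ⊑ Δ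
⊑-refl = tabulate member

Covered-resp-⊑ : ∀ {Δ Θ F} → Δ ⊑ Θ → Covered Δ F → Covered Θ F
Covered-resp-⊑ s (member m) = lookup s m
Covered-resp-⊑ s (both a b) = both (Covered-resp-⊑ s a) (Covered-resp-⊑ s b)
Covered-resp-⊑ s (left a)   = left (Covered-resp-⊑ s a)
Covered-resp-⊑ s (right b)  = right (Covered-resp-⊑ s b)

⊑-trans : ∀ {Γ Δ Θ} → Γ ⊑ Δ → Δ ⊑ Θ → Γ ⊑ Θ
⊑-trans c s = All.map (Covered-resp-⊑ s) c

⊑-replace : ∀ {F Δ Δ′ Θ} → F ∷ Δ′ ↭ Δ → Covered Θ F → Δ′ ⊆ Θ → Δ ⊑ Θ
⊑-replace p f s = All-resp-↭ p (f ∷ tabulate (member ∘ s))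

⊢G-focus : ∀ {F Δ C} → F ∈ Δ → (∀ {Δ′} → F ∷ Δ′ ↭ Δ → F ∷ Δ′ ⊢G C) → Δ ⊢G C
⊢G-focus F∈Δ k with ys , zs , refl ← ∈-∃++ F∈Δ = perm p (k p)
  where p = ↭-sym (shift _ ys zs)

⊢⇒⊢G-⊑ : ∀ {Γ Δ C} → Γ ⊢ C → Γ ⊑ Δ → Δ ⊢G C
⊢⇒⊢G-⊑ (ax∈ m) c with lookup c m
... | member m′ = ⊢G-focus m′ λ _ → ax
⊢⇒⊢G-⊑ (⊥L∈ m) c with lookup c m
... | member m′ = ⊢G-focus m′ λ _ → ⊥L
⊢⇒⊢G-⊑ (∧L∈ m d) c with lookup c m
... | member m′ = ⊢G-focus m′ λ p → ∧L (⊢⇒⊢G-⊑ d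
        (member₀ ∷ member₁ ∷ ⊑-trans c (⊑-replace p (both member₀ member₁) (there ∘ there))))
... | both a b  = ⊢⇒⊢G-⊑ d (a ∷ b ∷ c)
⊢⇒⊢G-⊑ (∨L∈ m d e) c with lookup c m
... | member m′ = ⊢G-focus m′ λ p → ∨L
        (⊢⇒⊢G-⊑ d (member₀ ∷ ⊑-trans c (⊑-replace p (left member₀) there)))
        (⊢⇒⊢G-⊑ e (member₀ ∷ ⊑-trans c (⊑-replace p (right member₀) there)))
... | left a    = ⊢⇒⊢G-⊑ d (a ∷ c)
... | right b   = ⊢⇒⊢G-⊑ e (b ∷ c)
⊢⇒⊢G-⊑ (∧R d e) c = ∧R (⊢⇒⊢G-⊑ d c) (⊢⇒⊢G-⊑ e c)
⊢⇒⊢G-⊑ (∨R1 d)  c = ∨R1 (⊢⇒⊢G-⊑ d c)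
⊢⇒⊢G-⊑ (∨R2 d)  c = ∨R2 (⊢⇒⊢G-⊑ d c)
⊢⇒⊢G-⊑ (⇒R d)   c = ⇒R (⊢⇒⊢G-⊑ d ⊑-refl)
⊢⇒⊢G-⊑ (⇒LR∈ m a b d e) c with lookup c m
... | member m′ = ⊢G-focus m′ λ _ →
        ⇒LR (⊢⇒⊢G-⊑ a ⊑-refl) (⊢⇒⊢G-⊑ b ⊑-refl) (⊢⇒⊢G-⊑ d ⊑-refl) (⊢⇒⊢G-⊑ e ⊑-refl)
⊢⇒⊢G-⊑ (⇒I d e) c = ⇒I (⊢⇒⊢G-⊑ d c) (⊢⇒⊢G-⊑ e c)
⊢⇒⊢G-⊑ (⇒C d e) c = ⇒C (⊢⇒⊢G-⊑ d c) (⊢⇒⊢G-⊑ e c)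

⊢⇒⊢G : ∀ {Γ C} → Γ ⊢ C → Γ ⊢G C
⊢⇒⊢G d = ⊢⇒⊢G-⊑ d ⊑-refl

⋀-proj : ∀ {F Γ} → F ∈ Γ → ⊢WFCI (⋀ Γ ⇒′ F)
⋀-proj {Γ = _ ∷ []}    (here refl) = axId
⋀-proj {Γ = _ ∷ _ ∷ _} (here refl) = ax∧1
⋀-proj {Γ = _ ∷ _ ∷ _} (there m)   = trans ax∧2 (⋀-proj m)

⋀-cons : ∀ {H X} Γ → ⊢WFCI (H ⇒′ X) → ⊢WFCI (H ⇒′ ⋀ Γ) → ⊢WFCI (H ⇒′ ⋀ (X ∷ Γ))
⋀-cons []      x g = x
⋀-cons (_ ∷ _) x g = conjI x g

⊢⇒⊢WFCI : ∀ {Γ C} → Γ ⊢ C → ⊢WFCI (⋀ Γ ⇒′ C)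
⊢⇒⊢WFCI (ax∈ m)  = ⋀-proj m
⊢⇒⊢WFCI (⊥L∈ m)  = trans (⋀-proj m) ax⊥
⊢⇒⊢WFCI {Γ} (∧L∈ {B = B} m d) =
  trans (⋀-cons (B ∷ Γ) (trans (⋀-proj m) ax∧1) (⋀-cons Γ (trans (⋀-proj m) ax∧2) axId))
        (⊢⇒⊢WFCI d)
⊢⇒⊢WFCI {Γ} (∨L∈ m d e) =
  trans (conjI axId (⋀-proj m))
        (trans axDist (disjE (trans (⋀-cons Γ ax∧2 ax∧1) (⊢⇒⊢WFCI d))
                             (trans (⋀-cons Γ ax∧2 ax∧1) (⊢⇒⊢WFCI e))))
⊢⇒⊢WFCI (∧R d e) = conjI (⊢⇒⊢WFCI d) (⊢⇒⊢WFCI e)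
⊢⇒⊢WFCI (∨R1 d)  = trans (⊢⇒⊢WFCI d) ax∨1
⊢⇒⊢WFCI (∨R2 d)  = trans (⊢⇒⊢WFCI d) ax∨2
⊢⇒⊢WFCI (⇒R d)   = weak (⊢⇒⊢WFCI d)
⊢⇒⊢WFCI (⇒LR∈ m ab ba cd dc) =
  trans (⋀-proj m)
        (mp (cong⇒ (adj (⊢⇒⊢WFCI ab) (⊢⇒⊢WFCI ba)) (adj (⊢⇒⊢WFCI cd) (⊢⇒⊢WFCI dc))) ax∧1)
⊢⇒⊢WFCI (⇒I d e) = trans (conjI (⊢⇒⊢WFCI d) (⊢⇒⊢WFCI e)) axTr
⊢⇒⊢WFCI (⇒C d e) = trans (conjI (⊢⇒⊢WFCI d) (⊢⇒⊢WFCI e)) axCj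

⊢WFCI⇒⊢ : ∀ {F} → ⊢WFCI F → [] ⊢ F
⊢WFCI⇒⊢ ax∨1    = ⇒R (∨R1 hyp₀)
⊢WFCI⇒⊢ ax∨2    = ⇒R (∨R2 hyp₀)
⊢WFCI⇒⊢ ax∧1    = ⇒R (∧L∈ (here refl) hyp₀)
⊢WFCI⇒⊢ ax∧2    = ⇒R (∧L∈ (here refl) hyp₁)
⊢WFCI⇒⊢ axDist  = ⇒R (∧L∈ (here refl) (∨L∈ (there (here refl))
                    (∨R1 (∧R hyp₁ hyp₀)) (∨R2 (∧R hyp₁ hyp₀))))
⊢WFCI⇒⊢ axId    = ⇒R hyp₀
⊢WFCI⇒⊢ ax⊥     = ⇒R (⊥L∈ (here refl))
⊢WFCI⇒⊢ (mp a f)      = cut (⊢WFCI⇒⊢ a) (⇒-inv (⊢WFCI⇒⊢ f)) ⊆-refl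
⊢WFCI⇒⊢ (weak a)      = ⇒R (weaken (λ ()) (⊢WFCI⇒⊢ a))
⊢WFCI⇒⊢ (trans f g)   = ⇒I (⊢WFCI⇒⊢ f) (⊢WFCI⇒⊢ g)
⊢WFCI⇒⊢ (conjI f g)   = ⇒C (⊢WFCI⇒⊢ f) (⊢WFCI⇒⊢ g)
⊢WFCI⇒⊢ (disjE f g)   = ⇒R (∨L∈ (here refl) (weaken (∷⁺ʳ _ λ ()) (⇒-inv (⊢WFCI⇒⊢ f)))
                                              (weaken (∷⁺ʳ _ λ ()) (⇒-inv (⊢WFCI⇒⊢ g))))
⊢WFCI⇒⊢ (adj a b)     = ∧R (⊢WFCI⇒⊢ a) (⊢WFCI⇒⊢ b)
⊢WFCI⇒⊢ (cong⇒ f g)   =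
  let ab , ba = ⇔-inv (⊢WFCI⇒⊢ f)
      cd , dc = ⇔-inv (⊢WFCI⇒⊢ g)
  in ∧R (⇒R (⇒LR∈ (here refl) ab ba cd dc)) (⇒R (⇒LR∈ (here refl) ba ab dc cd))
⊢WFCI⇒⊢ axTr = ⇒R (⇒I (∧L∈ (here refl) hyp₀) (∧L∈ (here refl) hyp₁))
⊢WFCI⇒⊢ axCj = ⇒R (⇒C (∧L∈ (here refl) hyp₀) (∧L∈ (here refl) hyp₁))

⋀⇒⊢ : ∀ Γ {C} → ⊢WFCI (⋀ Γ ⇒′ C) → Γ ⊢ C
⋀⇒⊢ Γ h = cut (⊢⋀ Γ) (⇒-inv (⊢WFCI⇒⊢ h)) (∷⁺ʳ _ λ ())

mainTheorem18 : (Γ : List Formula) (C : Formula)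
    → ((Γ ⊢G C) → ⊢WFCI (⋀ Γ ⇒′ C)) × (⊢WFCI (⋀ Γ ⇒′ C) → (Γ ⊢G C))
mainTheorem18 Γ C = ⊢⇒⊢WFCI ∘ ⊢G⇒⊢ , ⊢⇒⊢G ∘ ⋀⇒⊢ Γ
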